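{- For every integer $r\geq4$, the set of non-separating induced circuits of the prism $\Pr_r$ is exactly $\{\mathrm{C}_{r,1},\mathrm{C}_{r,2}\}\cup\{\mathrm{C}_{4,i}:0\leq i\leq r-1\}$, where $\mathrm{C}_{r,1}=x_0x_1\dots x_{r-1}x_0$, $\mathrm{C}_{r,2}=y_0y_1\dots y_{r-1}y_0$ and $\mathrm{C}_{4,i}=x_ix_{i+1}y_{i+1}y_ix_i$ (indices mod $r$). In particular $\Pr_r$ has exactly $r+2$ non-separating induced circuits.
   Context: The prism $\Pr_r$ has vertex set $\{x_0,\dots,x_{r-1},y_0,\dots,y_{r-1}\}$ and edges $x_ix_{i+1}$, $y_iy_{i+1}$, $x_iy_i$ for $0\leq i\leq r-1$ (indices mod $r$). A circuit $C$ in a graph $X$ is non-separating induced if $X-\mathrm{V}(C)$ is connected and $C$ has no chord in $X$. A circuit $v_0v_1\dots v_{\ell-1}v_0$ denotes the circuit with those consecutive edges. -}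

module Defs where

open import Data.Nat using (ℕ; suc; _≤_)
open import Data.Fin using (Fin; toℕ)
open import Data.Product using (Σ; ∃; _×_; _,_)
open import Data.Sum using (_⊎_)
open import Data.Empty using (⊥)
open import Relation.Nullary using (¬_)
open import Relation.Binary.PropositionalEquality using (_≡_)
open import Function.Bundles using (_⇔_)

Next : {n : ℕ} → Fin n → Fin n → Set
Next {n} i j = (toℕ j ≡ suc (toℕ i)) ⊎ ((toℕ j ≡ 0) × (suc (toℕ i) ≡ n))

Consec : {n : ℕ} → Fin n → Fin n → Set
Consec i j = Next i j ⊎ Next j i

data V (r : ℕ) : Set where
  x : Fin r → V r
  y : Fin r → V r

Adj : {r : ℕ} → V r → V r → Set
Adj (x i) (x j) = Consec i j
Adj (y i) (y j) = Consec i j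
Adj (x i) (y j) = i ≡ j
Adj (y i) (x j) = i ≡ j

record Circuit (r : ℕ) : Set where
  field
    len     : ℕ
    len≥3   : 3 ≤ len
    vtx     : Fin len → V r
    inj     : ∀ k k' → vtx k ≡ vtx k' → k ≡ k'
    closed  : ∀ k k' → Next k k' → Adj (vtx k) (vtx k')
open Circuit public

InC : {r : ℕ} → Circuit r → V r → Set
InC C v = ∃ λ k → vtx C k ≡ v

EdgeC : {r : ℕ} → Circuit r → V r → V r → Set
EdgeC C u v = ∃ λ k → ∃ λ k' → Consec k k' × vtx C k ≡ u × vtx C k' ≡ v

Induced : {r : ℕ} → Circuit r → Set
Induced C = ∀ u v → InC C u → InC C v → Adj u v → EdgeC C u v

data ReachAvoid {r : ℕ} (C : Circuit r) : V r → V r → Set where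
  here : ∀ {u} → ¬ InC C u → ReachAvoid C u u
  step : ∀ {u v w} → ¬ InC C u → Adj u v → ReachAvoid C v w → ReachAvoid C u w

NonSeparating : {r : ℕ} → Circuit r → Set
NonSeparating C = ∀ u v → ¬ InC C u → ¬ InC C v → ReachAvoid C u v

NonSepInduced : {r : ℕ} → Circuit r → Set
NonSepInduced C = NonSeparating C × Induced C

-- Edge sets (symmetric relations on vertices); a circuit is identified with its edge set
EdgeSet : ℕ → Set₁
EdgeSet r = V r → V r → Set

HasEdges : {r : ℕ} → Circuit r → EdgeSet r → Set
HasEdges C S = ∀ u v → EdgeC C u v ⇔ S u v

SameEdgeSet : {r : ℕ} → EdgeSet r → EdgeSet r → Set
SameEdgeSet S T = ∀ u v → S u v ⇔ T u v

Link : {r : ℕ} → V r → V r → EdgeSet r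
Link a b u v = (u ≡ a × v ≡ b) ⊎ (u ≡ b × v ≡ a)

Cr1 : {r : ℕ} → EdgeSet r
Cr1 (x i) (x j) = Consec i j
Cr1 _ _ = ⊥

Cr2 : {r : ℕ} → EdgeSet r
Cr2 (y i) (y j) = Consec i j
Cr2 _ _ = ⊥

-- C_{4,i} = x_i x_{i'} y_{i'} y_i x_i  where i' = i + 1 mod r  (given via Next i i')
C4 : {r : ℕ} → Fin r → Fin r → EdgeSet r
C4 i i' u v = Link (x i) (x i') u v ⊎ Link (x i') (y i') u v
            ⊎ Link (y i') (y i) u v ⊎ Link (y i) (x i) u v

Listed : {r : ℕ} → EdgeSet r → Set
Listed S = SameEdgeSet S Cr1 ⊎ SameEdgeSet S Cr2
         ⊎ (∃ λ i → ∃ λ i' → Next i i' × SameEdgeSet S (C4 i i'))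

-- A vertex of the prism has degree three, and a vertex of an induced circuit C has exactly two
-- neighbours on C. If C uses no rung x_i y_i it runs along one row and is then that whole row. If C uses
-- the rung at k, each row continues from it either to k + 1 or to k - 1. When both rows continue to the
-- same side, C closes up as the square on that side; when they part ways, C crosses the prism and cuts
-- the vertex at k + 1 outside C off from the one at k - 1 on the other row. Conversely the two rows and
-- the r squares are induced and non-separating, and the listed edge sets are told apart by single edges.

module Submission where

open import Defs
open import Data.Nat using (ℕ; zero; suc; _+_; _∸_; _≤_; z≤n; s≤s; _<?_)
open import Data.Nat.Properties
  using (suc-injective; 1+n≢0; <⇒≢; n<1+n; n≤1+n; +-identityʳ; ≤-antisym; ≮⇒≥; ≤-pred; ≤-trans; m∸n+n≡m)
open import Data.Fin using (Fin; zero; suc; toℕ; fromℕ; fromℕ<; inject₁)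
open import Data.Fin.Properties
  using (_≟_; any?; toℕ-injective; toℕ-fromℕ; toℕ-fromℕ<; toℕ-inject₁; toℕ<n)
open import Data.Product using (Σ; ∃; _×_; _,_; proj₁; proj₂)
open import Data.Sum using (_⊎_; inj₁; inj₂; [_,_]′)
open import Data.Empty using (⊥; ⊥-elim)
open import Relation.Nullary using (¬_; Dec; yes; no)
open import Relation.Nullary.Decidable using (map′; _×-dec_)
open import Function using (_∘_; id)
open import Function.Bundles using (_⇔_; mk⇔; Equivalence)
open import Function.Properties.Equivalence using () renaming (trans to ⇔-trans; sym to ⇔-sym)
open Equivalence using (to; from)
open import Relation.Binary.PropositionalEquality using (_≡_; _≢_; refl; sym; trans; cong; subst)

next : ∀ {n} → Fin n → Fin n
next {suc n} i with suc (toℕ i) <? suc n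
... | yes lt = fromℕ< lt
... | no _ = zero

prev : ∀ {n} → Fin n → Fin n
prev {suc n} zero = fromℕ n
prev {suc n} (suc j) = inject₁ j

next-Next : ∀ {n} (i : Fin n) → Next i (next i)
next-Next {suc n} i with suc (toℕ i) <? suc n
... | yes lt = inj₁ (toℕ-fromℕ< lt)
... | no ¬lt = inj₂ (refl , ≤-antisym (toℕ<n i) (≮⇒≥ ¬lt))

prev-Next : ∀ {n} (j : Fin n) → Next (prev j) j
prev-Next {suc n} zero = inj₂ (refl , cong suc (toℕ-fromℕ n))
prev-Next {suc n} (suc j) = inj₁ (cong suc (sym (toℕ-inject₁ j)))

Next-functional : ∀ {n} {i j j' : Fin n} → Next i j → Next i j' → j ≡ j'
Next-functional (inj₁ a) (inj₁ b) = toℕ-injective (trans a (sym b))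
Next-functional {j = j} (inj₁ a) (inj₂ (_ , b)) = ⊥-elim (<⇒≢ (toℕ<n j) (trans a b))
Next-functional {j' = j'} (inj₂ (_ , a)) (inj₁ b) = ⊥-elim (<⇒≢ (toℕ<n j') (trans b a))
Next-functional (inj₂ (a , _)) (inj₂ (b , _)) = toℕ-injective (trans a (sym b))

Next-injective : ∀ {n} {i i' j : Fin n} → Next i j → Next i' j → i ≡ i'
Next-injective (inj₁ a) (inj₁ b) = toℕ-injective (suc-injective (trans (sym a) b))
Next-injective (inj₁ a) (inj₂ (b , _)) = ⊥-elim (1+n≢0 (trans (sym a) b))
Next-injective (inj₂ (a , _)) (inj₁ b) = ⊥-elim (1+n≢0 (trans (sym b) a))
Next-injective (inj₂ (_ , a)) (inj₂ (_ , b)) = toℕ-injective (suc-injective (trans a (sym b)))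

Next⇒≡next : ∀ {n} {i j : Fin n} → Next i j → j ≡ next i
Next⇒≡next {i = i} nx = Next-functional nx (next-Next i)

Next⇒≡prev : ∀ {n} {i j : Fin n} → Next i j → i ≡ prev j
Next⇒≡prev {j = j} nx = Next-injective nx (prev-Next j)

prev-next : ∀ {n} (i : Fin n) → prev (next i) ≡ i
prev-next i = sym (Next⇒≡prev (next-Next i))

next-prev : ∀ {n} (j : Fin n) → next (prev j) ≡ j
next-prev j = sym (Next⇒≡next (prev-Next j))

Next-irrefl : ∀ {n} → 2 ≤ n → {i : Fin n} → ¬ Next i i
Next-irrefl _ {i} (inj₁ a) = <⇒≢ (n<1+n (toℕ i)) a
Next-irrefl (s≤s (s≤s _)) (inj₂ (a , b)) with trans (sym b) (cong suc a)
... | ()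

Next-asym : ∀ {n} → 3 ≤ n → {i j : Fin n} → Next i j → ¬ Next j i
Next-asym _ {i} (inj₁ a) (inj₁ b) = <⇒≢ (s≤s (n≤1+n (toℕ i))) (trans b (cong suc a))
Next-asym (s≤s (s≤s (s≤s _))) (inj₁ a) (inj₂ (b , c)) with trans (sym c) (cong suc (trans a (cong suc b)))
... | ()
Next-asym (s≤s (s≤s (s≤s _))) (inj₂ (a , c)) (inj₁ b) with trans (sym c) (cong suc (trans b (cong suc a)))
... | ()
Next-asym (s≤s (s≤s (s≤s _))) (inj₂ (a , c)) (inj₂ (b , _)) with trans (sym c) (cong suc b)
... | ()

Consec-irrefl : ∀ {n} → 2 ≤ n → {i : Fin n} → ¬ Consec i i
Consec-irrefl 2≤n (inj₁ nx) = Next-irrefl 2≤n nx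
Consec-irrefl 2≤n (inj₂ nx) = Next-irrefl 2≤n nx

next≢id : ∀ {n} → 2 ≤ n → (i : Fin n) → next i ≢ i
next≢id 2≤n i e = Next-irrefl 2≤n (subst (Next i) e (next-Next i))

next²≢id : ∀ {n} → 3 ≤ n → (i : Fin n) → next (next i) ≢ i
next²≢id 3≤n i e = Next-asym 3≤n (next-Next i) (subst (Next (next i)) e (next-Next (next i)))

next≢prev : ∀ {n} → 3 ≤ n → (i : Fin n) → next i ≢ prev i
next≢prev 3≤n i e = Next-asym 3≤n (next-Next i) (subst (λ j → Next j i) (sym e) (prev-Next i))

-- Climb from k to the last index, wrap around to 0, then climb to j.
cyclic-induction : ∀ {n} (P : Fin n → Set) → (∀ j → P j → P (next j)) → ∀ k → P k → ∀ j → P j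
cyclic-induction {suc m} P preserved k pk j = climb p₀ (toℕ j) j (sym (+-identityʳ (toℕ j)))
  where
  climb : ∀ {k} → P k → ∀ d j → toℕ j ≡ d + toℕ k → P j
  climb pk zero j e = subst P (toℕ-injective (sym e)) pk
  climb pk (suc d) j e with prev-Next j
  ... | inj₁ a = subst P (next-prev j) (preserved (prev j) (climb pk d (prev j) (suc-injective (trans (sym a) e))))
  ... | inj₂ (a , _) = ⊥-elim (1+n≢0 (trans (sym e) a))

  p-last : P (fromℕ m)
  p-last = climb pk (m ∸ toℕ k) (fromℕ m) (trans (toℕ-fromℕ m) (sym (m∸n+n≡m (≤-pred (toℕ<n k)))))

  p₀ : P zero
  p₀ = subst P (next-prev zero) (preserved (fromℕ m) p-last)

data Side : Set where
  top bottom : Side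

opposite : Side → Side
opposite top = bottom
opposite bottom = top

opposite-involutive : ∀ s → opposite (opposite s) ≡ s
opposite-involutive top = refl
opposite-involutive bottom = refl

row : ∀ {r} → Side → Fin r → V r
row top = x
row bottom = y

OnRow : ∀ {r} → Side → V r → Set
OnRow s w = ∃ λ j → w ≡ row s j

vertex-row : ∀ {r} (v : V r) → Σ Side λ s → OnRow s v
vertex-row (x i) = top , i , refl
vertex-row (y i) = bottom , i , refl

row-index : ∀ {r} s s' {i j : Fin r} → row s i ≡ row s' j → i ≡ j
row-index top top refl = refl
row-index bottom bottom refl = refl
row-index top bottom ()
row-index bottom top ()

row≢opposite : ∀ {r} s {i j : Fin r} → row s i ≢ row (opposite s) j
row≢opposite top ()
row≢opposite bottom ()

row-adj : ∀ {r} s {i j : Fin r} → Consec i j → Adj (row s i) (row s j)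
row-adj top c = c
row-adj bottom c = c

adj-row : ∀ {r} s {i j : Fin r} → Adj (row s i) (row s j) → Consec i j
adj-row top c = c
adj-row bottom c = c

rung : ∀ {r} s (i : Fin r) → Adj (row s i) (row (opposite s) i)
rung top i = refl
rung bottom i = refl

row-neighbours : ∀ {r} s (i : Fin r) w → Adj (row s i) w →
                 w ≡ row s (next i) ⊎ w ≡ row s (prev i) ⊎ w ≡ row (opposite s) i
row-neighbours top i (x j) (inj₁ nx) = inj₁ (cong x (Next⇒≡next nx))
row-neighbours top i (x j) (inj₂ nx) = inj₂ (inj₁ (cong x (Next⇒≡prev nx)))
row-neighbours top i (y j) refl = inj₂ (inj₂ refl)
row-neighbours bottom i (y j) (inj₁ nx) = inj₁ (cong y (Next⇒≡next nx))
row-neighbours bottom i (y j) (inj₂ nx) = inj₂ (inj₁ (cong y (Next⇒≡prev nx)))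
row-neighbours bottom i (x j) refl = inj₂ (inj₂ refl)

Adj-sym : ∀ {r} {u v : V r} → Adj u v → Adj v u
Adj-sym {u = x i} {x j} (inj₁ nx) = inj₂ nx
Adj-sym {u = x i} {x j} (inj₂ nx) = inj₁ nx
Adj-sym {u = x i} {y j} e = sym e
Adj-sym {u = y i} {x j} e = sym e
Adj-sym {u = y i} {y j} (inj₁ nx) = inj₂ nx
Adj-sym {u = y i} {y j} (inj₂ nx) = inj₁ nx

_≟ⱽ_ : ∀ {r} (u v : V r) → Dec (u ≡ v)
x i ≟ⱽ x j = map′ (cong x) (row-index top top) (i ≟ j)
y i ≟ⱽ y j = map′ (cong y) (row-index bottom bottom) (i ≟ j)
x i ≟ⱽ y j = no λ ()
y i ≟ⱽ x j = no λ ()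

rowCycle : ∀ {r} → Side → EdgeSet r
rowCycle top = Cr1
rowCycle bottom = Cr2

InducedEdges : ∀ {r} → (V r → Set) → EdgeSet r
InducedEdges T u v = T u × T v × Adj u v

InducedEdges-cong : ∀ {r} {T T' : V r → Set} → (∀ w → T w ⇔ T' w) →
                    ∀ u v → InducedEdges T u v ⇔ InducedEdges T' u v
InducedEdges-cong T⇔T' u v = mk⇔ (λ (tu , tv , a) → to (T⇔T' u) tu , to (T⇔T' v) tv , a)
                                 (λ (tu , tv , a) → from (T⇔T' u) tu , from (T⇔T' v) tv , a)

rowCycle⇔InducedEdges : ∀ {r} s (u v : V r) → rowCycle s u v ⇔ InducedEdges (OnRow s) u v
rowCycle⇔InducedEdges s u v = mk⇔ (edge s u v) (cycle s u v)
  where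
  edge : ∀ s u v → rowCycle s u v → InducedEdges (OnRow s) u v
  edge top (x i) (x j) c = (i , refl) , (j , refl) , c
  edge bottom (y i) (y j) c = (i , refl) , (j , refl) , c
  cycle : ∀ s u v → InducedEdges (OnRow s) u v → rowCycle s u v
  cycle top _ _ ((i , refl) , (j , refl) , a) = a
  cycle bottom _ _ ((i , refl) , (j , refl) , a) = a

InC? : ∀ {r} (C : Circuit r) v → Dec (InC C v)
InC? C v = any? λ k → vtx C k ≟ⱽ v

module _ {r : ℕ} {C : Circuit r} where

  ReachAvoid-source : ∀ {u v} → ReachAvoid C u v → ¬ InC C u
  ReachAvoid-source (here u∉) = u∉
  ReachAvoid-source (step u∉ _ _) = u∉

  ReachAvoid-snoc : ∀ {u v w} → ReachAvoid C u v → Adj v w → ¬ InC C w → ReachAvoid C u w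
  ReachAvoid-snoc (here u∉) a w∉ = step u∉ a (here w∉)
  ReachAvoid-snoc (step u∉ a p) b w∉ = step u∉ a (ReachAvoid-snoc p b w∉)

  ReachAvoid-trans : ∀ {u v w} → ReachAvoid C u v → ReachAvoid C v w → ReachAvoid C u w
  ReachAvoid-trans (here _) q = q
  ReachAvoid-trans (step u∉ a p) q = step u∉ a (ReachAvoid-trans p q)

  ReachAvoid-sym : ∀ {u v} → ReachAvoid C u v → ReachAvoid C v u
  ReachAvoid-sym (here u∉) = here u∉
  ReachAvoid-sym (step u∉ a p) = ReachAvoid-snoc (ReachAvoid-sym p) (Adj-sym a) u∉

  ReachAvoid-invariant : (I : V r → Set) → (∀ {u w} → I u → ¬ InC C u → ¬ InC C w → Adj u w → I w) →
                         ∀ {u v} → ReachAvoid C u v → I u → I v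
  ReachAvoid-invariant I I-step (here _) iu = iu
  ReachAvoid-invariant I I-step (step u∉ a p) iu =
    ReachAvoid-invariant I I-step p (I-step iu u∉ (ReachAvoid-source p) a)

  NonSeparating-hub : (t : V r) → (∀ u → ¬ InC C u → ReachAvoid C u t) → NonSeparating C
  NonSeparating-hub t reach u v u∉ v∉ = ReachAvoid-trans (reach u u∉) (ReachAvoid-sym (reach v v∉))

  row-reaches : ∀ s (B : Fin r → Set) t → ¬ InC C (row s t) → (∀ j → InC C (row s j) → B j) →
                (∀ j → B j → B (next j) ⊎ next j ≡ t) → ∀ j → ¬ B j → ReachAvoid C (row s j) (row s t)
  row-reaches s B t t∉ blocked B-next j ¬Bj =
    [ ⊥-elim ∘ ¬Bj , id ]′ (cyclic-induction Q Q-next t (inj₂ (here t∉)) j)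
    where
    Q : Fin r → Set
    Q j = B j ⊎ ReachAvoid C (row s j) (row s t)
    Q-next : ∀ j → Q j → Q (next j)
    Q-next j q with InC? C (row s (next j))
    ... | yes n∈ = inj₁ (blocked (next j) n∈)
    ... | no n∉ with q
    ...   | inj₂ p = inj₂ (step n∉ (row-adj s (inj₂ (next-Next j))) p)
    ...   | inj₁ b with B-next j b
    ...     | inj₁ b' = inj₁ b'
    ...     | inj₂ e = inj₂ (subst (λ k → ReachAvoid C (row s (next j)) (row s k)) e (here n∉))

data ExactlyTwo (A B D : Set) : Set where
  exceptThird  : A → B → ¬ D → ExactlyTwo A B D
  exceptSecond : A → ¬ B → D → ExactlyTwo A B D
  exceptFirst  : ¬ A → B → D → ExactlyTwo A B D

module _ {A B D : Set} where

  ExactlyTwo-¬third : ExactlyTwo A B D → ¬ D → A × B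
  ExactlyTwo-¬third (exceptThird a b _) _ = a , b
  ExactlyTwo-¬third (exceptSecond _ _ d) ¬d = ⊥-elim (¬d d)
  ExactlyTwo-¬third (exceptFirst _ _ d) ¬d = ⊥-elim (¬d d)

  ExactlyTwo-¬first : ExactlyTwo A B D → ¬ A → B × D
  ExactlyTwo-¬first (exceptThird a _ _) ¬a = ⊥-elim (¬a a)
  ExactlyTwo-¬first (exceptSecond a _ _) ¬a = ⊥-elim (¬a a)
  ExactlyTwo-¬first (exceptFirst _ b d) _ = b , d

  ExactlyTwo-first-third : ExactlyTwo A B D → A → D → ¬ B
  ExactlyTwo-first-third (exceptThird _ _ ¬d) _ d = ⊥-elim (¬d d)
  ExactlyTwo-first-third (exceptSecond _ ¬b _) _ _ = ¬b
  ExactlyTwo-first-third (exceptFirst ¬a _ _) a _ = ⊥-elim (¬a a)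

  ExactlyTwo-second-third : ExactlyTwo A B D → B → D → ¬ A
  ExactlyTwo-second-third (exceptThird _ _ ¬d) _ d = ⊥-elim (¬d d)
  ExactlyTwo-second-third (exceptSecond _ ¬b _) b _ = ⊥-elim (¬b b)
  ExactlyTwo-second-third (exceptFirst ¬a _ _) _ _ = ¬a

module _ {r : ℕ} (C : Circuit r) where

  vtx-next-adj : ∀ k → Adj (vtx C k) (vtx C (next k))
  vtx-next-adj k = closed C k (next k) (next-Next k)

  vtx-prev-adj : ∀ k → Adj (vtx C k) (vtx C (prev k))
  vtx-prev-adj k = Adj-sym (closed C (prev k) k (prev-Next k))

  vtx-next≢prev : ∀ k → vtx C (next k) ≢ vtx C (prev k)
  vtx-next≢prev k = next≢prev (len≥3 C) k ∘ inj C _ _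

  some-row-vertex : Σ Side λ s → ∃ λ j → InC C (row s j)
  some-row-vertex = let (s , j , e) = vertex-row (vtx C k₀) in s , j , k₀ , e
    where
    k₀ : Fin (len C)
    k₀ = fromℕ< (≤-trans (s≤s z≤n) (len≥3 C))

  circuit-edge : ∀ k → EdgeC C (vtx C k) (vtx C (next k))
  circuit-edge k = k , next k , inj₁ (next-Next k) , refl , refl

  circuit-edge⁻¹ : ∀ k → EdgeC C (vtx C (next k)) (vtx C k)
  circuit-edge⁻¹ k = next k , k , inj₂ (next-Next k) , refl , refl

  EdgeC⇒InducedEdges : ∀ u v → EdgeC C u v → InducedEdges (InC C) u v
  EdgeC⇒InducedEdges _ _ (k , k' , inj₁ nx , refl , refl) = (k , refl) , (k' , refl) , closed C k k' nx
  EdgeC⇒InducedEdges _ _ (k , k' , inj₂ nx , refl , refl) = (k , refl) , (k' , refl) , Adj-sym (closed C k' k nx)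

  edges-from-vertices : Induced C → {T : V r → Set} → (∀ w → InC C w ⇔ T w) →
                        {E : EdgeSet r} → (∀ u v → E u v ⇔ InducedEdges T u v) → SameEdgeSet (EdgeC C) E
  edges-from-vertices ind C⇔T E⇔ u v =
    ⇔-trans (mk⇔ (EdgeC⇒InducedEdges u v) (λ (u∈ , v∈ , a) → ind u v u∈ v∈ a))
            (⇔-trans (InducedEdges-cong C⇔T u v) (⇔-sym (E⇔ u v)))

  vertices-closed : (T : V r → Set) → (∀ u w → InC C u → T u → InC C w → Adj u w → T w) →
                    ∀ u → InC C u → T u → ∀ w → InC C w → T w
  vertices-closed T T-adj _ (k , refl) tk _ (k' , refl) =
    cyclic-induction (T ∘ vtx C) (λ j tj → T-adj _ _ (j , refl) tj (next j , refl) (vtx-next-adj j)) k tk k'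

  module _ (ind : Induced C) where

    induced-neighbour : ∀ k w → Adj (vtx C k) w → InC C w → w ≡ vtx C (next k) ⊎ w ≡ vtx C (prev k)
    induced-neighbour k w a w∈ with ind (vtx C k) w (k , refl) w∈ a
    ... | k₁ , k₂ , c , e₁ , refl with inj C k₁ k e₁ | c
    ...   | refl | inj₁ nx = inj₁ (cong (vtx C) (Next⇒≡next nx))
    ...   | refl | inj₂ nx = inj₂ (cong (vtx C) (Next⇒≡prev nx))

    chordless : ∀ k {w} → Adj (vtx C k) w → vtx C (next k) ≢ w → vtx C (prev k) ≢ w → ¬ InC C w
    chordless k a n≢ p≢ w∈ = [ n≢ ∘ sym , p≢ ∘ sym ]′ (induced-neighbour k _ a w∈)

    degree-two : ∀ {u a b d} → InC C u → Adj u a → Adj u b → Adj u d → a ≢ b → a ≢ d → b ≢ d →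
                 (∀ w → Adj u w → w ≡ a ⊎ w ≡ b ⊎ w ≡ d) → ExactlyTwo (InC C a) (InC C b) (InC C d)
    degree-two (k , refl) a-adj b-adj d-adj a≢b a≢d b≢d cover
      with cover _ (vtx-next-adj k) | cover _ (vtx-prev-adj k)
    ... | inj₁ refl        | inj₂ (inj₁ refl) = exceptThird (_ , refl) (_ , refl) (chordless k d-adj a≢d b≢d)
    ... | inj₁ refl        | inj₂ (inj₂ refl) = exceptSecond (_ , refl) (chordless k b-adj a≢b (b≢d ∘ sym)) (_ , refl)
    ... | inj₂ (inj₁ refl) | inj₁ refl        = exceptThird (_ , refl) (_ , refl) (chordless k d-adj b≢d a≢d)
    ... | inj₂ (inj₁ refl) | inj₂ (inj₂ refl) = exceptFirst (chordless k a-adj (a≢b ∘ sym) (a≢d ∘ sym)) (_ , refl) (_ , refl)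
    ... | inj₂ (inj₂ refl) | inj₁ refl        = exceptSecond (_ , refl) (chordless k b-adj (b≢d ∘ sym) a≢b) (_ , refl)
    ... | inj₂ (inj₂ refl) | inj₂ (inj₁ refl) = exceptFirst (chordless k a-adj (a≢d ∘ sym) (a≢b ∘ sym)) (_ , refl) (_ , refl)
    ... | inj₁ p        | inj₁ q        = ⊥-elim (vtx-next≢prev k (trans p (sym q)))
    ... | inj₂ (inj₁ p) | inj₂ (inj₁ q) = ⊥-elim (vtx-next≢prev k (trans p (sym q)))
    ... | inj₂ (inj₂ p) | inj₂ (inj₂ q) = ⊥-elim (vtx-next≢prev k (trans p (sym q)))

OnSquare : ∀ {r} → Fin r → V r → Set
OnSquare i w = Σ Side λ s → w ≡ row s i ⊎ w ≡ row s (next i)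

listed-row : ∀ {r} {S : EdgeSet r} s → SameEdgeSet S (rowCycle s) → Listed S
listed-row top = inj₁
listed-row bottom = inj₂ ∘ inj₁

listed-square : ∀ {r} {S : EdgeSet r} i → SameEdgeSet S (C4 i (next i)) → Listed S
listed-square i same = inj₂ (inj₂ (i , next i , next-Next i , same))

C4⇔InducedEdges : ∀ {r} → 2 ≤ r → ∀ (i : Fin r) u v → C4 i (next i) u v ⇔ InducedEdges (OnSquare i) u v
C4⇔InducedEdges 2≤r i u v = mk⇔ (corners-of u v) (edge-of u v)
  where
  loop : ∀ {j} → ¬ Consec j j
  loop = Consec-irrefl 2≤r
  i'≢i : next i ≢ i
  i'≢i = next≢id 2≤r i
  corners-of : ∀ u v → C4 i (next i) u v → InducedEdges (OnSquare i) u v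
  corners-of _ _ (inj₁ (inj₁ (refl , refl))) = (top , inj₁ refl) , (top , inj₂ refl) , inj₁ (next-Next i)
  corners-of _ _ (inj₁ (inj₂ (refl , refl))) = (top , inj₂ refl) , (top , inj₁ refl) , inj₂ (next-Next i)
  corners-of _ _ (inj₂ (inj₁ (inj₁ (refl , refl)))) = (top , inj₂ refl) , (bottom , inj₂ refl) , refl
  corners-of _ _ (inj₂ (inj₁ (inj₂ (refl , refl)))) = (bottom , inj₂ refl) , (top , inj₂ refl) , refl
  corners-of _ _ (inj₂ (inj₂ (inj₁ (inj₁ (refl , refl))))) = (bottom , inj₂ refl) , (bottom , inj₁ refl) , inj₂ (next-Next i)
  corners-of _ _ (inj₂ (inj₂ (inj₁ (inj₂ (refl , refl))))) = (bottom , inj₁ refl) , (bottom , inj₂ refl) , inj₁ (next-Next i)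
  corners-of _ _ (inj₂ (inj₂ (inj₂ (inj₁ (refl , refl))))) = (bottom , inj₁ refl) , (top , inj₁ refl) , refl
  corners-of _ _ (inj₂ (inj₂ (inj₂ (inj₂ (refl , refl))))) = (top , inj₁ refl) , (bottom , inj₁ refl) , refl
  edge-of : ∀ u v → InducedEdges (OnSquare i) u v → C4 i (next i) u v
  edge-of _ _ ((top , inj₁ refl) , (top , inj₁ refl) , a) = ⊥-elim (loop a)
  edge-of _ _ ((top , inj₁ refl) , (top , inj₂ refl) , _) = inj₁ (inj₁ (refl , refl))
  edge-of _ _ ((top , inj₁ refl) , (bottom , inj₁ refl) , _) = inj₂ (inj₂ (inj₂ (inj₂ (refl , refl))))
  edge-of _ _ ((top , inj₁ refl) , (bottom , inj₂ refl) , a) = ⊥-elim (i'≢i (sym a))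
  edge-of _ _ ((top , inj₂ refl) , (top , inj₁ refl) , _) = inj₁ (inj₂ (refl , refl))
  edge-of _ _ ((top , inj₂ refl) , (top , inj₂ refl) , a) = ⊥-elim (loop a)
  edge-of _ _ ((top , inj₂ refl) , (bottom , inj₁ refl) , a) = ⊥-elim (i'≢i a)
  edge-of _ _ ((top , inj₂ refl) , (bottom , inj₂ refl) , _) = inj₂ (inj₁ (inj₁ (refl , refl)))
  edge-of _ _ ((bottom , inj₁ refl) , (top , inj₁ refl) , _) = inj₂ (inj₂ (inj₂ (inj₁ (refl , refl))))
  edge-of _ _ ((bottom , inj₁ refl) , (top , inj₂ refl) , a) = ⊥-elim (i'≢i (sym a))
  edge-of _ _ ((bottom , inj₁ refl) , (bottom , inj₁ refl) , a) = ⊥-elim (loop a)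
  edge-of _ _ ((bottom , inj₁ refl) , (bottom , inj₂ refl) , _) = inj₂ (inj₂ (inj₁ (inj₂ (refl , refl))))
  edge-of _ _ ((bottom , inj₂ refl) , (top , inj₁ refl) , a) = ⊥-elim (i'≢i a)
  edge-of _ _ ((bottom , inj₂ refl) , (top , inj₂ refl) , _) = inj₂ (inj₁ (inj₂ (refl , refl)))
  edge-of _ _ ((bottom , inj₂ refl) , (bottom , inj₁ refl) , _) = inj₂ (inj₂ (inj₁ (inj₁ (refl , refl))))
  edge-of _ _ ((bottom , inj₂ refl) , (bottom , inj₂ refl) , a) = ⊥-elim (loop a)

module Classification {r : ℕ} (r3 : 3 ≤ r) (C : Circuit r) (ind : Induced C) where

  row-degree : ∀ s i → InC C (row s i) →
               ExactlyTwo (InC C (row s (next i))) (InC C (row s (prev i))) (InC C (row (opposite s) i))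
  row-degree s i i∈ = degree-two C ind i∈ (row-adj s (inj₁ (next-Next i))) (row-adj s (inj₂ (prev-Next i)))
                        (rung s i) (next≢prev r3 i ∘ row-index s s) (row≢opposite s) (row≢opposite s)
                        (row-neighbours s i)

  row-vertices : ∀ s k → InC C (row s k) → (∀ j → InC C (row s j) → ¬ InC C (row (opposite s) j)) →
                 ∀ w → InC C w ⇔ OnRow s w
  row-vertices s k k∈ no-rung w = mk⇔ (vertices-closed C (OnRow s) along-row _ k∈ (k , refl) w) whole-row
    where
    along-row : ∀ u w → InC C u → OnRow s u → InC C w → Adj u w → OnRow s w
    along-row _ w u∈ (j , refl) w∈ a with row-neighbours s j w a
    ... | inj₁ e = next j , e
    ... | inj₂ (inj₁ e) = prev j , e
    ... | inj₂ (inj₂ refl) = ⊥-elim (no-rung j u∈ w∈)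
    whole-row : OnRow s w → InC C w
    whole-row (j , refl) = cyclic-induction (InC C ∘ row s)
      (λ j j∈ → proj₁ (ExactlyTwo-¬third (row-degree s j j∈) (no-rung j j∈))) k k∈ j

  square-vertices : ∀ i → (∀ s → InC C (row s i) × InC C (row s (next i))) → ∀ w → InC C w ⇔ OnSquare i w
  square-vertices i corners w =
    mk⇔ (vertices-closed C (OnSquare i) around _ (proj₁ (corners top)) (top , inj₁ refl) w) corner
    where
    around : ∀ u w → InC C u → OnSquare i u → InC C w → Adj u w → OnSquare i w
    around _ w u∈ (s , inj₁ refl) w∈ a with row-neighbours s i w a
    ... | inj₁ e = s , inj₂ e
    ... | inj₂ (inj₁ refl) =
      ⊥-elim (ExactlyTwo-first-third (row-degree s i u∈) (proj₂ (corners s)) (proj₁ (corners (opposite s))) w∈)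
    ... | inj₂ (inj₂ e) = opposite s , inj₁ e
    around _ w u∈ (s , inj₂ refl) w∈ a with row-neighbours s (next i) w a
    ... | inj₁ refl = ⊥-elim (ExactlyTwo-second-third (row-degree s (next i) u∈)
                                (subst (InC C ∘ row s) (sym (prev-next i)) (proj₁ (corners s)))
                                (proj₂ (corners (opposite s))) w∈)
    ... | inj₂ (inj₁ e) = s , inj₁ (trans e (cong (row s) (prev-next i)))
    ... | inj₂ (inj₂ e) = opposite s , inj₂ e
    corner : OnSquare i w → InC C w
    corner (s , inj₁ refl) = proj₁ (corners s)
    corner (s , inj₂ refl) = proj₂ (corners s)

  -- Everything reachable outside C from the other row at k + 1 stays on that row, opposite vertices of C:
  -- such a C-vertex has its rung outside C, so C continues along row b on both sides of it. Row b at k - 1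
  -- lies outside C and is therefore unreachable.
  rung-crossing-separates : ∀ b k → InC C (row b k) → InC C (row b (next k)) → InC C (row (opposite b) k) →
                            ¬ InC C (row (opposite b) (next k)) → ¬ NonSeparating C
  rung-crossing-separates b k k∈ n∈ k'∈ n'∉ ns =
    let (_ , on-opposite-row , _) = ReachAvoid-invariant Shadowed shadow-step (ns _ _ n'∉ p∉) (next k , refl , n∈)
    in row≢opposite b on-opposite-row
    where
    Shadowed : V r → Set
    Shadowed w = ∃ λ j → w ≡ row (opposite b) j × InC C (row b j)
    p∉ : ¬ InC C (row b (prev k))
    p∉ = ExactlyTwo-first-third (row-degree b k k∈) n∈ k'∈
    shadow-step : ∀ {u w} → Shadowed u → ¬ InC C u → ¬ InC C w → Adj u w → Shadowed w
    shadow-step (j , refl , j∈) u∉ w∉ a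
      with ExactlyTwo-¬third (row-degree b j j∈) u∉ | row-neighbours (opposite b) j _ a
    ... | j'∈ , _ | inj₁ e = next j , e , j'∈
    ... | _ , j'∈ | inj₂ (inj₁ e) = prev j , e , j'∈
    ... | _ | inj₂ (inj₂ e) = ⊥-elim (w∉ (subst (InC C) (sym (trans e back)) j∈))
      where
      back : row (opposite (opposite b)) j ≡ row b j
      back = cong (λ t → row t j) (opposite-involutive b)

  2≤r : 2 ≤ r
  2≤r = ≤-trans (n≤1+n 2) r3

  square-listed : ∀ i → InC C (x i) → InC C (x (next i)) → InC C (y i) → InC C (y (next i)) → Listed (EdgeC C)
  square-listed i xi∈ xi'∈ yi∈ yi'∈ =
    listed-square i (edges-from-vertices C ind (square-vertices i corners) (C4⇔InducedEdges 2≤r i))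
    where
    corners : ∀ s → InC C (row s i) × InC C (row s (next i))
    corners top = xi∈ , xi'∈
    corners bottom = yi∈ , yi'∈

  no-rung-on : ∀ s → ¬ (∃ λ j → InC C (x j) × InC C (y j)) →
               ∀ j → InC C (row s j) → ¬ InC C (row (opposite s) j)
  no-rung-on top no-rung j xj∈ yj∈ = no-rung (j , xj∈ , yj∈)
  no-rung-on bottom no-rung j yj∈ xj∈ = no-rung (j , xj∈ , yj∈)

  classification : NonSeparating C → Listed (EdgeC C)
  classification ns with any? (λ j → InC? C (x j) ×-dec InC? C (y j))
  ... | no no-rung with some-row-vertex C
  ...   | s , k , k∈ =
    listed-row s
      (edges-from-vertices C ind (row-vertices s k k∈ (no-rung-on s no-rung)) (rowCycle⇔InducedEdges s))
  classification ns | yes (k , xk∈ , yk∈) with InC? C (x (next k)) | InC? C (y (next k))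
  ... | yes xk'∈ | yes yk'∈ = square-listed k xk∈ xk'∈ yk∈ yk'∈
  ... | yes xk'∈ | no yk'∉ = ⊥-elim (rung-crossing-separates top k xk∈ xk'∈ yk∈ yk'∉ ns)
  ... | no xk'∉ | yes yk'∈ = ⊥-elim (rung-crossing-separates bottom k yk∈ yk'∈ xk∈ xk'∉ ns)
  ... | no xk'∉ | no yk'∉ =
    square-listed (prev k)
      (proj₁ (ExactlyTwo-¬first (row-degree top k xk∈) xk'∉)) (subst (InC C ∘ x) (sym (next-prev k)) xk∈)
      (proj₁ (ExactlyTwo-¬first (row-degree bottom k yk∈) yk'∉)) (subst (InC C ∘ y) (sym (next-prev k)) yk∈)

rowCircuit : ∀ {r} → 3 ≤ r → Side → Circuit r
rowCircuit r3 s = record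
  { len = _ ; len≥3 = r3 ; vtx = row s ; inj = λ _ _ → row-index s s ; closed = λ _ _ nx → row-adj s (inj₁ nx) }

module _ {r : ℕ} (r3 : 3 ≤ r) where

  rowCircuit-vertices : ∀ s w → InC (rowCircuit r3 s) w ⇔ OnRow s w
  rowCircuit-vertices s w = mk⇔ (λ (k , e) → k , sym e) (λ (k , e) → k , sym e)

  rowCircuit-induced : ∀ s → Induced (rowCircuit r3 s)
  rowCircuit-induced s _ _ (k , refl) (k' , refl) a = k , k' , adj-row s a , refl , refl

  off-rowCircuit : ∀ s w → ¬ InC (rowCircuit r3 s) w → OnRow (opposite s) w
  off-rowCircuit top (x i) w∉ = ⊥-elim (w∉ (i , refl))
  off-rowCircuit top (y i) _ = i , refl
  off-rowCircuit bottom (x i) _ = i , refl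
  off-rowCircuit bottom (y i) w∉ = ⊥-elim (w∉ (i , refl))

  rowCircuit-nonseparating : ∀ s → NonSeparating (rowCircuit r3 s)
  rowCircuit-nonseparating s u v u∉ v∉ with off-rowCircuit s u u∉ | off-rowCircuit s v v∉
  ... | a , refl | b , refl =
    row-reaches (opposite s) (λ _ → ⊥) b v∉ (λ _ (_ , e) → row≢opposite s e) (λ _ ()) a λ ()

  rowCircuit-edges : ∀ s → HasEdges (rowCircuit r3 s) (rowCycle s)
  rowCircuit-edges s =
    edges-from-vertices (rowCircuit r3 s) (rowCircuit-induced s) (rowCircuit-vertices s) (rowCycle⇔InducedEdges s)

corner : ∀ {r} → Fin r → Fin 4 → V r
corner i zero = x i
corner i (suc zero) = x (next i)
corner i (suc (suc zero)) = y (next i)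
corner i (suc (suc (suc zero))) = y i

corner-injective : ∀ {r} → 2 ≤ r → (i : Fin r) → ∀ k k' → corner i k ≡ corner i k' → k ≡ k'
corner-injective 2≤r i = injective
  where
  i'≢i : next i ≢ i
  i'≢i = next≢id 2≤r i
  injective : ∀ k k' → corner i k ≡ corner i k' → k ≡ k'
  injective zero zero _ = refl
  injective zero (suc zero) e = ⊥-elim (i'≢i (sym (row-index top top e)))
  injective zero (suc (suc zero)) ()
  injective zero (suc (suc (suc zero))) ()
  injective (suc zero) zero e = ⊥-elim (i'≢i (row-index top top e))
  injective (suc zero) (suc zero) _ = refl
  injective (suc zero) (suc (suc zero)) ()
  injective (suc zero) (suc (suc (suc zero))) ()
  injective (suc (suc zero)) zero ()
  injective (suc (suc zero)) (suc zero) ()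
  injective (suc (suc zero)) (suc (suc zero)) _ = refl
  injective (suc (suc zero)) (suc (suc (suc zero))) e = ⊥-elim (i'≢i (row-index bottom bottom e))
  injective (suc (suc (suc zero))) zero ()
  injective (suc (suc (suc zero))) (suc zero) ()
  injective (suc (suc (suc zero))) (suc (suc zero)) e = ⊥-elim (i'≢i (sym (row-index bottom bottom e)))
  injective (suc (suc (suc zero))) (suc (suc (suc zero))) _ = refl

corner-next-adj : ∀ {r} (i : Fin r) k → Adj (corner i k) (corner i (next k))
corner-next-adj i zero = inj₁ (next-Next i)
corner-next-adj i (suc zero) = refl
corner-next-adj i (suc (suc zero)) = inj₂ (next-Next i)
corner-next-adj i (suc (suc (suc zero))) = refl

squareCircuit : ∀ {r} → 2 ≤ r → Fin r → Circuit r
squareCircuit 2≤r i = record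
  { len = 4 ; len≥3 = n≤1+n 3 ; vtx = corner i ; inj = corner-injective 2≤r i
  ; closed = λ k k' nx → subst (Adj (corner i k) ∘ corner i) (sym (Next⇒≡next nx)) (corner-next-adj i k) }

module _ {r : ℕ} (r3 : 3 ≤ r) (i : Fin r) where

  private
    2≤r : 2 ≤ r
    2≤r = ≤-trans (n≤1+n 2) r3
    square : Circuit r
    square = squareCircuit 2≤r i

  squareCircuit-vertices : ∀ w → InC square w ⇔ OnSquare i w
  squareCircuit-vertices w = mk⇔ on-square at-corner
    where
    on-square : InC square w → OnSquare i w
    on-square (zero , refl) = top , inj₁ refl
    on-square (suc zero , refl) = top , inj₂ refl
    on-square (suc (suc zero) , refl) = bottom , inj₂ refl
    on-square (suc (suc (suc zero)) , refl) = bottom , inj₁ refl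
    at-corner : OnSquare i w → InC square w
    at-corner (top , inj₁ refl) = zero , refl
    at-corner (top , inj₂ refl) = suc zero , refl
    at-corner (bottom , inj₂ refl) = suc (suc zero) , refl
    at-corner (bottom , inj₁ refl) = suc (suc (suc zero)) , refl

  C4⇒EdgeC : ∀ u v → C4 i (next i) u v → EdgeC square u v
  C4⇒EdgeC _ _ (inj₁ (inj₁ (refl , refl))) = circuit-edge square zero
  C4⇒EdgeC _ _ (inj₁ (inj₂ (refl , refl))) = circuit-edge⁻¹ square zero
  C4⇒EdgeC _ _ (inj₂ (inj₁ (inj₁ (refl , refl)))) = circuit-edge square (suc zero)
  C4⇒EdgeC _ _ (inj₂ (inj₁ (inj₂ (refl , refl)))) = circuit-edge⁻¹ square (suc zero)
  C4⇒EdgeC _ _ (inj₂ (inj₂ (inj₁ (inj₁ (refl , refl))))) = circuit-edge square (suc (suc zero))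
  C4⇒EdgeC _ _ (inj₂ (inj₂ (inj₁ (inj₂ (refl , refl))))) = circuit-edge⁻¹ square (suc (suc zero))
  C4⇒EdgeC _ _ (inj₂ (inj₂ (inj₂ (inj₁ (refl , refl))))) = circuit-edge square (suc (suc (suc zero)))
  C4⇒EdgeC _ _ (inj₂ (inj₂ (inj₂ (inj₂ (refl , refl))))) = circuit-edge⁻¹ square (suc (suc (suc zero)))

  squareCircuit-induced : Induced square
  squareCircuit-induced u v u∈ v∈ a =
    C4⇒EdgeC u v (from (C4⇔InducedEdges 2≤r i u v)
                       (to (squareCircuit-vertices u) u∈ , to (squareCircuit-vertices v) v∈ , a))

  squareCircuit-edges : HasEdges square (C4 i (next i))
  squareCircuit-edges = edges-from-vertices square squareCircuit-induced squareCircuit-vertices (C4⇔InducedEdges 2≤r i)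

  squareCircuit-nonseparating : NonSeparating square
  squareCircuit-nonseparating = NonSeparating-hub (x i'') to-hub
    where
    i'' : Fin r
    i'' = next (next i)
    Blocked : Fin r → Set
    Blocked j = j ≡ i ⊎ j ≡ next i
    blocked : ∀ s j → InC square (row s j) → Blocked j
    blocked s j j∈ with to (squareCircuit-vertices _) j∈
    ... | s' , inj₁ e = inj₁ (row-index s s' e)
    ... | s' , inj₂ e = inj₂ (row-index s s' e)
    Blocked-next : ∀ j → Blocked j → Blocked (next j) ⊎ next j ≡ i''
    Blocked-next _ (inj₁ refl) = inj₁ (inj₂ refl)
    Blocked-next _ (inj₂ refl) = inj₂ refl
    i''∉ : ∀ s → ¬ InC square (row s i'')
    i''∉ s i''∈ = [ next²≢id r3 i , next≢id 2≤r (next i) ]′ (blocked s i'' i''∈)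
    along : ∀ s j → ¬ InC square (row s j) → ReachAvoid square (row s j) (row s i'')
    along s j j∉ = row-reaches s Blocked i'' (i''∉ s) (blocked s) Blocked-next j (j∉ ∘ from (squareCircuit-vertices _) ∘ on-square)
      where
      on-square : Blocked j → OnSquare i (row s j)
      on-square (inj₁ refl) = s , inj₁ refl
      on-square (inj₂ refl) = s , inj₂ refl
    to-hub : ∀ u → ¬ InC square u → ReachAvoid square u (x i'')
    to-hub u u∉ with vertex-row u
    ... | top , j , refl = along top j u∉
    ... | bottom , j , refl = ReachAvoid-snoc (along bottom j u∉) refl (i''∉ top)

realise : ∀ {r} {C : Circuit r} {E S : EdgeSet r} → NonSepInduced C → HasEdges C E → SameEdgeSet S E →
          Σ (Circuit r) λ C → NonSepInduced C × HasEdges C S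
realise {C = C} nsi edges same = C , nsi , λ u v → ⇔-trans (edges u v) (⇔-sym (same u v))

Cr1≉Cr2 : ∀ {r} → Fin r → ¬ SameEdgeSet {r} Cr1 Cr2
Cr1≉Cr2 i same = to (same (x i) (x (next i))) (inj₁ (next-Next i))

C4≉Cr1 : ∀ {r} (i i' : Fin r) → ¬ SameEdgeSet (C4 i i') Cr1
C4≉Cr1 i i' same = to (same (x i) (y i)) (inj₂ (inj₂ (inj₂ (inj₂ (refl , refl)))))

C4≉Cr2 : ∀ {r} (i i' : Fin r) → ¬ SameEdgeSet (C4 i i') Cr2
C4≉Cr2 i i' same = to (same (x i) (x i')) (inj₁ (inj₁ (refl , refl)))

C4-rung : ∀ {r} {i i' a : Fin r} → C4 i i' (x a) (y a) → a ≡ i' ⊎ a ≡ i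
C4-rung (inj₁ (inj₁ (_ , ())))
C4-rung (inj₁ (inj₂ (_ , ())))
C4-rung (inj₂ (inj₁ (inj₁ (e , _)))) = inj₁ (row-index top top e)
C4-rung (inj₂ (inj₁ (inj₂ (() , _))))
C4-rung (inj₂ (inj₂ (inj₁ (inj₁ (() , _)))))
C4-rung (inj₂ (inj₂ (inj₁ (inj₂ (() , _)))))
C4-rung (inj₂ (inj₂ (inj₂ (inj₁ (() , _)))))
C4-rung (inj₂ (inj₂ (inj₂ (inj₂ (e , _))))) = inj₂ (row-index top top e)

C4-injective : ∀ {r} → 3 ≤ r → ∀ {i i' j j' : Fin r} → Next i i' → Next j j' →
               SameEdgeSet (C4 i i') (C4 j j') → i ≡ j
C4-injective r3 {i} {i'} nx ny same
  with C4-rung (to (same (x i) (y i)) (inj₂ (inj₂ (inj₂ (inj₂ (refl , refl))))))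
... | inj₂ i≡j = i≡j
... | inj₁ refl with C4-rung (to (same (x i') (y i')) (inj₂ (inj₁ (inj₁ (refl , refl)))))
...   | inj₁ refl = ⊥-elim (Next-irrefl (≤-trans (n≤1+n 2) r3) nx)
...   | inj₂ refl = ⊥-elim (Next-asym r3 nx ny)

lemma4p2 : ∀ (r : ℕ) → 4 ≤ r →
    (∀ (C : Circuit r) → NonSepInduced C → Listed (EdgeC C))
    × (∀ (S : EdgeSet r) → Listed S → Σ (Circuit r) λ C → NonSepInduced C × HasEdges C S)
    × ¬ SameEdgeSet {r} Cr1 Cr2
    × (∀ (i i' : Fin r) → Next i i' → ¬ SameEdgeSet (C4 i i') Cr1)
    × (∀ (i i' : Fin r) → Next i i' → ¬ SameEdgeSet (C4 i i') Cr2)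
    × (∀ (i i' j j' : Fin r) → Next i i' → Next j j' → SameEdgeSet (C4 i i') (C4 j j') → i ≡ j)
lemma4p2 r@(suc _) 4≤r =
    (λ C (ns , ind) → Classification.classification r3 C ind ns)
  , realised
  , Cr1≉Cr2 zero
  , (λ i i' _ → C4≉Cr1 i i')
  , (λ i i' _ → C4≉Cr2 i i')
  , (λ i i' j j' → C4-injective r3)
  where
  r3 : 3 ≤ r
  r3 = ≤-trans (n≤1+n 3) 4≤r
  row-nsi : ∀ s → NonSepInduced (rowCircuit r3 s)
  row-nsi s = rowCircuit-nonseparating r3 s , rowCircuit-induced r3 s
  realised : ∀ S → Listed S → Σ (Circuit r) λ C → NonSepInduced C × HasEdges C S
  realised S (inj₁ same) = realise (row-nsi top) (rowCircuit-edges r3 top) same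
  realised S (inj₂ (inj₁ same)) = realise (row-nsi bottom) (rowCircuit-edges r3 bottom) same
  realised S (inj₂ (inj₂ (i , _ , nx , same))) rewrite Next⇒≡next nx =
    realise (squareCircuit-nonseparating r3 i , squareCircuit-induced r3 i) (squareCircuit-edges r3 i) same
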